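{- Let $M$ be a closed term of the untyped $\lambda$-calculus and $m,n\ge 0$. Then $M$ is of arity $m\rightarrow n$ if and only if $M^\bullet\circ\mathbf{B}^{m+1}=_{\beta\eta}(\mathbf{B}\,M)\circ\mathbf{B}^n$.
   Context: Work in the untyped $\lambda$-calculus with $\beta\eta$-equality $=_{\beta\eta}$. Put $\mathbf{I}=\lambda f.f$, $\mathbf{B}=\lambda fxy.f\,(x\,y)$, and for a closed term $P$, $P^\bullet=\lambda f.f\,P$. For terms $M,N$ write $M\circ N=\mathbf{B}\,M\,N$. Let $\mathbf{B}^0=\mathbf{I}$ and $\mathbf{B}^{k+1}=\mathbf{B}\circ\mathbf{B}^k$. A closed term $M$ is of arity $m\rightarrow n$ if $M=_{\beta\eta}\lambda f x_1\dots x_m.f\,M_1\dots M_n$ for some terms $M_1,\dots,M_n$ in which $f$ does not occur free. -}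

module Defs where

open import Data.Nat using (ℕ; zero; suc; _+_)
open import Data.Fin using (Fin; zero; suc; _↑ʳ_; _↑ˡ_)
open import Data.Vec using (Vec; []; _∷_; foldl)

data Tm (n : ℕ) : Set where
  var : Fin n → Tm n
  lam : Tm (suc n) → Tm n
  app : Tm n → Tm n → Tm n

ext : ∀ {m n} → (Fin m → Fin n) → Fin (suc m) → Fin (suc n)
ext ρ zero    = zero
ext ρ (suc i) = suc (ρ i)

ren : ∀ {m n} → (Fin m → Fin n) → Tm m → Tm n
ren ρ (var i)   = var (ρ i)
ren ρ (lam t)   = lam (ren (ext ρ) t)
ren ρ (app t u) = app (ren ρ t) (ren ρ u)

exts : ∀ {m n} → (Fin m → Tm n) → Fin (suc m) → Tm (suc n)
exts σ zero    = var zero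
exts σ (suc i) = ren suc (σ i)

sub : ∀ {m n} → (Fin m → Tm n) → Tm m → Tm n
sub σ (var i)   = σ i
sub σ (lam t)   = lam (sub (exts σ) t)
sub σ (app t u) = app (sub σ t) (sub σ u)

sub0 : ∀ {n} → Tm n → Fin (suc n) → Tm n
sub0 u zero    = u
sub0 u (suc i) = var i

_[_] : ∀ {n} → Tm (suc n) → Tm n → Tm n
t [ u ] = sub (sub0 u) t

infix 4 _=βη_
data _=βη_ {n : ℕ} : Tm n → Tm n → Set where
  β     : ∀ (t : Tm (suc n)) (u : Tm n) → app (lam t) u =βη t [ u ]
  η     : ∀ (t : Tm n) → lam (app (ren suc t) (var zero)) =βη t
  refl  : ∀ {t} → t =βη t
  sym   : ∀ {t u} → t =βη u → u =βη t
  trans : ∀ {t u v} → t =βη u → u =βη v → t =βη v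
  app-cong : ∀ {t t' u u'} → t =βη t' → u =βη u' → app t u =βη app t' u'
  lam-cong : ∀ {t t' : Tm (suc n)} → t =βη t' → lam t =βη lam t'

Closed : Set
Closed = Tm 0

close : ∀ {n} → Closed → Tm n
close = ren (λ ())

𝐈 : Closed
𝐈 = lam (var zero)

-- B = λ f x y. f (x y)
𝐁 : Closed
𝐁 = lam (lam (lam (app (var (suc (suc zero))) (app (var (suc zero)) (var zero)))))

_• : Closed → Closed
P • = lam (app (var zero) (close P))

infixr 9 _∘_
_∘_ : Closed → Closed → Closed
M ∘ N = app (app 𝐁 M) N

𝐁^ : ℕ → Closed
𝐁^ zero    = 𝐈
𝐁^ (suc k) = 𝐁 ∘ 𝐁^ k

-- k-fold abstraction: lams k t = λ x_1 ... x_k . t  (x_k has index 0)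
lams : ∀ {n} k → Tm (k + n) → Tm n
lams zero    t = t
lams (suc k) t = lams k (lam t)

apps : ∀ {k n} → Tm k → Vec (Tm k) n → Tm k
apps h args = foldl (λ _ → _) app h args

-- M is of arity m → n:
--   M =βη λ f x_1 ... x_m . f M_1 ... M_n  with f not free in any M_i.
-- The body lives in context f, x_1, ..., x_m (size m + 1), where f has
-- de Bruijn index m (m ↑ʳ zero); "f not free in M_i" is expressed by
-- taking M_i : Tm m (context x_1..x_m only) and weakening via _↑ˡ 1.
record Arity (M : Closed) (m n : ℕ) : Set where
  constructor arity
  field
    args : Vec (Tm m) n
    eq   : M =βη lam (lams m (apps (var (m ↑ʳ zero))
                                   (Data.Vec.map (ren (_↑ˡ 1)) args)))

-- Applied to z g x₁ … xₘ, the left side reduces to z (M g x⃗) and the right side to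
-- M (𝐁ⁿ z g) x⃗. If M has arity m → n, both are z (g M₁ … Mₙ) with the xᵢ substituted.
-- Conversely, let 𝐓 n be the tupling combinator (𝐓 n y₁ … yₙ s = s y₁ … yₙ) with projections πᵢ.
-- For z = λt. f (t π₁) … (t πₙ) we have 𝐁ⁿ z (𝐓 n) = f, hence
-- M f x⃗ = z (M (𝐓 n) x⃗) = f (P π₁) … (P πₙ) with P = M (𝐓 n) x⃗, in which f does not occur.

module Submission where

open import Defs
open import Data.Nat using (ℕ; zero; suc; _+_)
open import Data.Nat.Properties using (+-comm)
open import Data.Fin using (Fin; zero; suc; _↑ʳ_; _↑ˡ_)
open import Data.Vec using (Vec; []; _∷_; map; tabulate; lookup; _∷ʳ_)
open import Data.Vec.Properties using (map-∘; map-cong; map-∷ʳ; tabulate-∘; tabulate-cong; tabulate∘lookup)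
open import Function.Bundles using (_⇔_; mk⇔)
open import Relation.Binary.Bundles using (Setoid)
import Relation.Binary.Reasoning.Setoid as SetoidReasoning
open import Relation.Binary.PropositionalEquality as ≡ using (_≡_; cong; cong₂)

Ren : ℕ → ℕ → Set
Ren m n = Fin m → Fin n

Sub : ℕ → ℕ → Set
Sub m n = Fin m → Tm n

ren-id : ∀ {n} {ρ : Ren n n} → (∀ i → ρ i ≡ i) → ∀ t → ren ρ t ≡ t
ren-id h (var i)   = cong var (h i)
ren-id h (lam t)   = cong lam (ren-id (λ { zero → ≡.refl ; (suc i) → cong suc (h i) }) t)
ren-id h (app t u) = cong₂ app (ren-id h t) (ren-id h u)

ren-ren : ∀ {l m n} {ρ : Ren m n} {ρ' : Ren l m} {ρ'' : Ren l n} →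
          (∀ i → ρ (ρ' i) ≡ ρ'' i) → ∀ t → ren ρ (ren ρ' t) ≡ ren ρ'' t
ren-ren h (var i)   = cong var (h i)
ren-ren h (lam t)   = cong lam (ren-ren (λ { zero → ≡.refl ; (suc i) → cong suc (h i) }) t)
ren-ren h (app t u) = cong₂ app (ren-ren h t) (ren-ren h u)

ren-comm : ∀ {l m m' n} {ρ₁ : Ren m n} {ρ₂ : Ren l m} {ρ₃ : Ren m' n} {ρ₄ : Ren l m'} →
           (∀ i → ρ₁ (ρ₂ i) ≡ ρ₃ (ρ₄ i)) → ∀ t → ren ρ₁ (ren ρ₂ t) ≡ ren ρ₃ (ren ρ₄ t)
ren-comm h t = ≡.trans (ren-ren h t) (≡.sym (ren-ren (λ _ → ≡.refl) t))

sub-id : ∀ {n} {σ : Sub n n} → (∀ i → σ i ≡ var i) → ∀ t → sub σ t ≡ t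
sub-id h (var i)   = h i
sub-id h (lam t)   = cong lam (sub-id (λ { zero → ≡.refl ; (suc i) → cong (ren suc) (h i) }) t)
sub-id h (app t u) = cong₂ app (sub-id h t) (sub-id h u)

sub-ren : ∀ {l m n} {σ : Sub m n} {ρ : Ren l m} (τ : Sub l n) →
          (∀ i → σ (ρ i) ≡ τ i) → ∀ t → sub σ (ren ρ t) ≡ sub τ t
sub-ren τ h (var i)   = h i
sub-ren τ h (lam t)   =
  cong lam (sub-ren (exts τ) (λ { zero → ≡.refl ; (suc i) → cong (ren suc) (h i) }) t)
sub-ren τ h (app t u) = cong₂ app (sub-ren τ h t) (sub-ren τ h u)

ren-sub : ∀ {l m n} {ρ : Ren m n} {σ : Sub l m} (τ : Sub l n) →
          (∀ i → ren ρ (σ i) ≡ τ i) → ∀ t → ren ρ (sub σ t) ≡ sub τ t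
ren-sub τ h (var i)   = h i
ren-sub {σ = σ} τ h (lam t) = cong lam (ren-sub (exts τ) exts-h t)
  where
  exts-h : ∀ i → ren (ext _) (exts σ i) ≡ exts τ i
  exts-h zero    = ≡.refl
  exts-h (suc i) = ≡.trans (ren-comm (λ _ → ≡.refl) (σ i)) (cong (ren suc) (h i))
ren-sub τ h (app t u) = cong₂ app (ren-sub τ h t) (ren-sub τ h u)

ren≡sub : ∀ {m n} {ρ : Ren m n} (σ : Sub m n) → (∀ i → var (ρ i) ≡ σ i) → ∀ t → ren ρ t ≡ sub σ t
ren≡sub σ h (var i)   = h i
ren≡sub σ h (lam t)   =
  cong lam (ren≡sub (exts σ) (λ { zero → ≡.refl ; (suc i) → cong (ren suc) (h i) }) t)
ren≡sub σ h (app t u) = cong₂ app (ren≡sub σ h t) (ren≡sub σ h u)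

wk-[] : ∀ {n} (t u : Tm n) → ren suc t [ u ] ≡ t
wk-[] t u = ≡.trans (sub-ren var (λ _ → ≡.refl) t) (sub-id (λ _ → ≡.refl) t)

wk-wk-[][] : ∀ {k} (a b c : Tm k) → sub (exts (sub0 b)) (ren suc (ren suc a)) [ c ] ≡ a
wk-wk-[][] a b c = ≡.trans (cong (_[ c ])
    (≡.trans (sub-ren (λ i → ren suc (sub0 b i)) (λ _ → ≡.refl) (ren suc a))
    (≡.trans (sub-ren (λ i → var (suc i)) (λ _ → ≡.refl) a) (≡.sym (ren≡sub _ (λ _ → ≡.refl) a)))))
  (wk-[] a c)

ren-[] : ∀ {m n} (ρ : Ren m n) t u → ren ρ (t [ u ]) ≡ ren (ext ρ) t [ ren ρ u ]
ren-[] ρ t u = ≡.trans (ren-sub (λ i → ren ρ (sub0 u i)) (λ _ → ≡.refl) t)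
  (≡.sym (sub-ren (λ i → ren ρ (sub0 u i)) (λ { zero → ≡.refl ; (suc i) → ≡.refl }) t))

≡⇒=βη : ∀ {n} {t u : Tm n} → t ≡ u → t =βη u
≡⇒=βη ≡.refl = refl

ren-=βη : ∀ {m n} (ρ : Ren m n) {t u} → t =βη u → ren ρ t =βη ren ρ u
ren-=βη ρ (β t u)         = trans (β _ _) (≡⇒=βη (≡.sym (ren-[] ρ t u)))
ren-=βη ρ (η t)           =
  trans (≡⇒=βη (cong (λ t' → lam (app t' (var zero))) (ren-comm (λ _ → ≡.refl) t))) (η _)
ren-=βη ρ refl            = refl
ren-=βη ρ (sym e)         = sym (ren-=βη ρ e)
ren-=βη ρ (trans e e')    = trans (ren-=βη ρ e) (ren-=βη ρ e')
ren-=βη ρ (app-cong e e') = app-cong (ren-=βη ρ e) (ren-=βη ρ e')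
ren-=βη ρ (lam-cong e)    = lam-cong (ren-=βη (ext ρ) e)

=βη-setoid : ℕ → Setoid _ _
=βη-setoid n = record
  { Carrier       = Tm n
  ; _≈_           = _=βη_
  ; isEquivalence = record { refl = refl ; sym = sym ; trans = trans }
  }

module βη-Reasoning {n : ℕ} = SetoidReasoning (=βη-setoid n)

close-=βη : ∀ {k} {A B : Closed} → A =βη B → close {k} A =βη close B
close-=βη = ren-=βη _

ren-close : ∀ {m n} (ρ : Ren m n) (X : Closed) → ren ρ (close X) ≡ close X
ren-close ρ X = ren-ren (λ ()) X

sub-close : ∀ {m n} (σ : Sub m n) (X : Closed) → sub σ (close X) ≡ close X
sub-close σ X = ≡.trans (sub-ren (λ ()) (λ ()) X) (≡.sym (ren≡sub (λ ()) (λ ()) X))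

sub-ren-close : ∀ {l m n} (σ : Sub m n) (ρ : Ren l m) (X : Closed) → sub σ (ren ρ (close X)) ≡ close X
sub-ren-close σ ρ X = ≡.trans (cong (sub σ) (ren-close ρ X)) (sub-close σ X)

close₀ : (X : Closed) → close X ≡ X
close₀ = ren-id (λ ())

close-η : (X : Closed) → lam (app (close X) (var zero)) =βη X
close-η X = trans (≡⇒=βη (cong (λ t → lam (app t (var zero))) (≡.sym (ren-close suc X))))
                  (trans (η _) (≡⇒=βη (close₀ X)))

close-η² : (X : Closed) → lam (lam (app (app (close X) (var (suc zero))) (var zero))) =βη X
close-η² X = trans (lam-cong (trans
    (≡⇒=βη (cong (λ t → lam (app (app t (var (suc zero))) (var zero))) (≡.sym (ren-close suc X))))
    (η _)))
  (close-η X)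

apps-congˡ : ∀ {k n} {h h' : Tm k} (xs : Vec (Tm k) n) → h =βη h' → apps h xs =βη apps h' xs
apps-congˡ []       e = e
apps-congˡ (x ∷ xs) e = apps-congˡ xs (app-cong e refl)

apps-cong-tabulate : ∀ {k} n (h : Tm k) {F G : Fin n → Tm k} → (∀ i → F i =βη G i) →
                     apps h (tabulate F) =βη apps h (tabulate G)
apps-cong-tabulate zero    h e = refl
apps-cong-tabulate (suc n) h {F} e =
  trans (apps-congˡ (tabulate (λ i → F (suc i))) (app-cong refl (e zero)))
        (apps-cong-tabulate n _ (λ i → e (suc i)))

apps-hom : ∀ {k k'} (F : Tm k → Tm k') → (∀ a b → F (app a b) ≡ app (F a) (F b)) →
           ∀ {n} h (xs : Vec (Tm k) n) → F (apps h xs) ≡ apps (F h) (map F xs)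
apps-hom F hom h []       = ≡.refl
apps-hom F hom h (x ∷ xs) =
  ≡.trans (apps-hom F hom (app h x) xs) (cong (λ h' → apps h' (map F xs)) (hom h x))

ren-apps : ∀ {k k' n} (ρ : Ren k k') h (xs : Vec (Tm k) n) →
           ren ρ (apps h xs) ≡ apps (ren ρ h) (map (ren ρ) xs)
ren-apps ρ = apps-hom (ren ρ) (λ _ _ → ≡.refl)

sub-apps : ∀ {k k' n} (σ : Sub k k') h (xs : Vec (Tm k) n) →
           sub σ (apps h xs) ≡ apps (sub σ h) (map (sub σ) xs)
sub-apps σ = apps-hom (sub σ) (λ _ _ → ≡.refl)

apps-∷ʳ : ∀ {k n} (h : Tm k) (xs : Vec (Tm k) n) x → apps h (xs ∷ʳ x) ≡ app (apps h xs) x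
apps-∷ʳ h []       x = ≡.refl
apps-∷ʳ h (y ∷ xs) x = apps-∷ʳ (app h y) xs x

lams-cong : ∀ {n} k {t u : Tm (k + n)} → t =βη u → lams k t =βη lams k u
lams-cong zero    e = e
lams-cong (suc k) e = lams-cong k (lam-cong e)

vars : ∀ m n → Vec (Tm (m + n)) m
vars zero    n = []
vars (suc m) n = map (ren suc) (vars m n) ∷ʳ var zero

vars₀ : ∀ m → Vec (Tm m) m
vars₀ zero    = []
vars₀ (suc m) = map (ren suc) (vars₀ m) ∷ʳ var zero

map-↑ˡ-vars₀ : ∀ m n → map (ren (_↑ˡ n)) (vars₀ m) ≡ vars m n
map-↑ˡ-vars₀ zero    n = ≡.refl
map-↑ˡ-vars₀ (suc m) n = begin
    map (ren (_↑ˡ n)) (map (ren suc) (vars₀ m) ∷ʳ var zero)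
  ≡⟨ map-∷ʳ (ren (_↑ˡ n)) (var zero) (map (ren suc) (vars₀ m)) ⟩
    map (ren (_↑ˡ n)) (map (ren suc) (vars₀ m)) ∷ʳ var zero
  ≡⟨ cong (_∷ʳ var zero) (map-∘ (ren (_↑ˡ n)) (ren suc) (vars₀ m)) ⟨
    map (λ t → ren (_↑ˡ n) (ren suc t)) (vars₀ m) ∷ʳ var zero
  ≡⟨ cong (_∷ʳ var zero) (map-cong (ren-comm (λ _ → ≡.refl)) (vars₀ m)) ⟩
    map (λ t → ren suc (ren (_↑ˡ n) t)) (vars₀ m) ∷ʳ var zero
  ≡⟨ cong (_∷ʳ var zero) (map-∘ (ren suc) (ren (_↑ˡ n)) (vars₀ m)) ⟩
    map (ren suc) (map (ren (_↑ˡ n)) (vars₀ m)) ∷ʳ var zero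
  ≡⟨ cong (λ vs → map (ren suc) vs ∷ʳ var zero) (map-↑ˡ-vars₀ m n) ⟩
    vars (suc m) n
  ∎
  where open ≡.≡-Reasoning

apps-↑ʳ-vars-suc : ∀ {n} m (t : Tm n) →
  apps (ren (suc m ↑ʳ_) t) (vars (suc m) n) ≡ app (ren suc (apps (ren (m ↑ʳ_) t) (vars m n))) (var zero)
apps-↑ʳ-vars-suc {n} m t = begin
    apps (ren (suc m ↑ʳ_) t) (map (ren suc) (vars m n) ∷ʳ var zero)
  ≡⟨ apps-∷ʳ (ren (suc m ↑ʳ_) t) (map (ren suc) (vars m n)) (var zero) ⟩
    app (apps (ren (suc m ↑ʳ_) t) (map (ren suc) (vars m n))) (var zero)
  ≡⟨ cong (λ t' → app (apps t' (map (ren suc) (vars m n))) (var zero)) (ren-ren (λ _ → ≡.refl) t) ⟨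
    app (apps (ren suc (ren (m ↑ʳ_) t)) (map (ren suc) (vars m n))) (var zero)
  ≡⟨ cong (λ t' → app t' (var zero)) (ren-apps suc (ren (m ↑ʳ_) t) (vars m n)) ⟨
    app (ren suc (apps (ren (m ↑ʳ_) t) (vars m n))) (var zero)
  ∎
  where open ≡.≡-Reasoning

lams-η : ∀ {n} m (t : Tm n) → lams m (apps (ren (m ↑ʳ_) t) (vars m n)) =βη t
lams-η zero    t = ≡⇒=βη (ren-id (λ _ → ≡.refl) t)
lams-η (suc m) t = begin
    lams m (lam (apps (ren (suc m ↑ʳ_) t) (vars (suc m) _)))
  ≡⟨ cong (λ u → lams m (lam u)) (apps-↑ʳ-vars-suc m t) ⟩
    lams m (lam (app (ren suc (apps (ren (m ↑ʳ_) t) (vars m _))) (var zero)))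
  ≈⟨ lams-cong m (η _) ⟩
    lams m (apps (ren (m ↑ʳ_) t) (vars m _))
  ≈⟨ lams-η m t ⟩
    t
  ∎
  where open βη-Reasoning

lams-β : ∀ {n} m (b : Tm (m + n)) → apps (ren (m ↑ʳ_) (lams m b)) (vars m n) =βη b
lams-β zero    b = ≡⇒=βη (ren-id (λ _ → ≡.refl) b)
lams-β (suc m) b = begin
    apps (ren (suc m ↑ʳ_) (lams m (lam b))) (vars (suc m) _)
  ≡⟨ apps-↑ʳ-vars-suc m (lams m (lam b)) ⟩
    app (ren suc (apps (ren (m ↑ʳ_) (lams m (lam b))) (vars m _))) (var zero)
  ≈⟨ app-cong (ren-=βη suc (lams-β m (lam b))) refl ⟩
    app (lam (ren (ext suc) b)) (var zero)
  ≈⟨ β _ _ ⟩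
    ren (ext suc) b [ var zero ]
  ≡⟨ sub-ren var (λ { zero → ≡.refl ; (suc i) → ≡.refl }) b ⟩
    sub var b
  ≡⟨ sub-id (λ _ → ≡.refl) b ⟩
    b
  ∎
  where open βη-Reasoning

lams-ext : ∀ {n} m {t u : Tm n} →
           apps (ren (m ↑ʳ_) t) (vars m n) =βη apps (ren (m ↑ʳ_) u) (vars m n) → t =βη u
lams-ext m {t} {u} e = trans (sym (lams-η m t)) (trans (lams-cong m e) (lams-η m u))

𝐁-β : ∀ {k} (a b c : Tm k) → app (app (app (close 𝐁) a) b) c =βη app a (app b c)
𝐁-β a b c = trans (app-cong (app-cong (β _ a) refl) refl) (trans (app-cong (β _ b) refl)
  (trans (β _ c) (≡⇒=βη (cong₂ app (wk-wk-[][] a b c) (cong₂ app (wk-[] b c) ≡.refl)))))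

𝐁^-β : ∀ n {k} (a b : Tm k) (ys : Vec (Tm k) n) →
       apps (app (app (close (𝐁^ n)) a) b) ys =βη app a (apps b ys)
𝐁^-β zero    a b []       = app-cong (β _ a) refl
𝐁^-β (suc n) a b (y ∷ ys) =
  trans (apps-congˡ ys (trans (app-cong (app-cong (𝐁-β _ _ _) refl) refl) (𝐁-β _ _ _)))
        (𝐁^-β n a (app b y) ys)

•-β : ∀ {k} (X : Closed) (a : Tm k) → app (close (X •)) a =βη app a (close X)
•-β X a = trans (β _ a) (≡⇒=βη (cong (app a) (sub-ren-close _ _ X)))

𝐊 : Closed
𝐊 = lam (lam (var (suc zero)))

𝐊-β : ∀ {k} (a b : Tm k) → app (app (close 𝐊) a) b =βη a
𝐊-β a b = trans (app-cong (β _ a) refl) (trans (β _ b) (≡⇒=βη (wk-[] a b)))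

𝐂' : Closed
𝐂' = lam (lam (lam (app (var (suc zero)) (app (var zero) (var (suc (suc zero)))))))

𝐂'-β : ∀ {k} (y t s : Tm k) → app (app (app (close 𝐂') y) t) s =βη app t (app s y)
𝐂'-β y t s = trans (app-cong (app-cong (β _ y) refl) refl) (trans (app-cong (β _ t) refl)
  (trans (β _ s) (≡⇒=βη (cong₂ app (wk-[] t s) (cong₂ app ≡.refl (wk-wk-[][] y t s))))))

𝐃 : ℕ → Closed
𝐃 zero    = 𝐈
𝐃 (suc n) = app (app 𝐁 𝐊) (𝐃 n)

𝐃-β : ∀ n {k} (y : Tm k) (zs : Vec (Tm k) n) → apps (app (close (𝐃 n)) y) zs =βη y
𝐃-β zero    y []       = β _ y
𝐃-β (suc n) y (z ∷ zs) =
  trans (apps-congˡ zs (trans (app-cong (𝐁-β _ _ _) refl) (𝐊-β _ _))) (𝐃-β n y zs)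

π : ∀ n → Fin n → Closed
π (suc n) zero    = 𝐃 n
π (suc n) (suc i) = app 𝐊 (π n i)

π-β : ∀ n i {k} (ys : Vec (Tm k) n) → apps (close (π n i)) ys =βη lookup ys i
π-β (suc n) zero    (y ∷ ys) = 𝐃-β n y ys
π-β (suc n) (suc i) (y ∷ ys) = trans (apps-congˡ ys (𝐊-β _ _)) (π-β n i ys)

𝐓 : ℕ → Closed
𝐓 zero    = 𝐈
𝐓 (suc n) = lam (app (app (close (𝐁^ n)) (app (close 𝐂') (var zero))) (close (𝐓 n)))

𝐓-β : ∀ n {k} (ys : Vec (Tm k) n) (s : Tm k) → app (apps (close (𝐓 n)) ys) s =βη apps s ys
𝐓-β zero    []       s = β _ s
𝐓-β (suc n) (y ∷ ys) s = trans (app-cong (apps-congˡ ys (trans (β _ y) (≡⇒=βη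
    (cong₂ app (cong₂ app (sub-ren-close _ _ (𝐁^ n)) ≡.refl)
               (sub-ren-close _ _ (𝐓 n)))))) refl)
  (trans (app-cong (𝐁^-β n _ _ ys) refl) (trans (𝐂'-β _ _ _) (𝐓-β n ys (app s y))))

project : ∀ {k} n → Tm k → Vec (Tm k) n
project n t = tabulate (λ i → app t (close (π n i)))

map-project : ∀ {k k'} n (F : Tm k → Tm k') → (∀ a b → F (app a b) ≡ app (F a) (F b)) →
              (∀ X → F (close X) ≡ close X) → ∀ t → map F (project n t) ≡ project n (F t)
map-project n F hom fix t = ≡.trans (≡.sym (tabulate-∘ F _))
  (tabulate-cong (λ i → ≡.trans (hom t _) (cong (app (F t)) (fix (π n i)))))

uncurry : ∀ {k} n → Tm k → Tm k
uncurry n h = lam (apps (ren suc h) (project n (var zero)))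

uncurry-β : ∀ {k} n (h t : Tm k) → app (uncurry n h) t =βη apps h (project n t)
uncurry-β n h t = trans (β _ t) (≡⇒=βη (≡.trans (sub-apps (sub0 t) (ren suc h) (project n (var zero)))
  (cong₂ apps (wk-[] h t) (map-project n (sub (sub0 t)) (λ _ _ → ≡.refl) (sub-close _) (var zero)))))

ren-uncurry : ∀ {k k'} n (ρ : Ren k k') (h : Tm k) → ren ρ (uncurry n h) ≡ uncurry n (ren ρ h)
ren-uncurry n ρ h = cong lam (≡.trans (ren-apps (ext ρ) (ren suc h) (project n (var zero)))
  (cong₂ apps (ren-comm (λ _ → ≡.refl) h)
              (map-project n (ren (ext ρ)) (λ _ _ → ≡.refl) (ren-close _) (var zero))))

𝐁^-uncurry-𝐓 : ∀ {k} n (f : Tm k) → app (app (close (𝐁^ n)) (uncurry n f)) (close (𝐓 n)) =βη f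
𝐁^-uncurry-𝐓 {k} n f = lams-ext n (begin
    apps (ren (n ↑ʳ_) (app (app (close (𝐁^ n)) (uncurry n f)) (close (𝐓 n)))) ys
  ≡⟨ cong (λ t → apps t ys)
       (cong₂ app (cong₂ app (ren-close _ (𝐁^ n)) (ren-uncurry n _ f)) (ren-close _ (𝐓 n))) ⟩
    apps (app (app (close (𝐁^ n)) (uncurry n f')) (close (𝐓 n))) ys
  ≈⟨ 𝐁^-β n _ _ ys ⟩
    app (uncurry n f') (apps (close (𝐓 n)) ys)
  ≈⟨ uncurry-β n f' _ ⟩
    apps f' (project n (apps (close (𝐓 n)) ys))
  ≈⟨ apps-cong-tabulate n f' (λ i → trans (𝐓-β n ys _) (π-β n i ys)) ⟩
    apps f' (tabulate (lookup ys))
  ≡⟨ cong (apps f') (tabulate∘lookup ys) ⟩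
    apps f' ys
  ∎)
  where
  open βη-Reasoning
  ys : Vec (Tm (n + k)) n
  ys = vars n k
  f' : Tm (n + k)
  f' = ren (n ↑ʳ_) f

•∘𝐁^-β : ∀ {k} M m (z g : Tm k) (xs : Vec (Tm k) m) →
         apps (app (close ((M •) ∘ 𝐁^ (m + 1))) z) (g ∷ xs) =βη app z (apps (close M) (g ∷ xs))
•∘𝐁^-β M m z g xs = trans (apps-congˡ (g ∷ xs) (trans (𝐁-β _ _ _) (•-β M _)))
  (trans (≡⇒=βη (cong (λ j → apps (app (app (close (𝐁^ j)) z) (close M)) (g ∷ xs)) (+-comm m 1)))
         (𝐁^-β (suc m) z (close M) (g ∷ xs)))

𝐁∘𝐁^-β : ∀ {k} M m n (z g : Tm k) (xs : Vec (Tm k) m) →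
         apps (app (close (app 𝐁 M ∘ 𝐁^ n)) z) (g ∷ xs)
           =βη apps (close M) (app (app (close (𝐁^ n)) z) g ∷ xs)
𝐁∘𝐁^-β M m n z g xs = apps-congˡ xs (trans (app-cong (𝐁-β _ _ _) refl) (𝐁-β _ _ _))

closed-ext : ∀ m {C D : Closed} →
  apps (app (app (close C) (var (m ↑ʳ suc zero))) (var (m ↑ʳ zero))) (vars m 2)
    =βη apps (app (app (close D) (var (m ↑ʳ suc zero))) (var (m ↑ʳ zero))) (vars m 2) →
  C =βη D
closed-ext m {C} {D} e =
  trans (sym (close-η² C)) (trans (lam-cong (lam-cong (lams-ext m e'))) (close-η² D))
  where
  ren-close-app² : (X : Closed) → ren (m ↑ʳ_) (app (app (close X) (var (suc zero))) (var zero))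
                         ≡ app (app (close X) (var (m ↑ʳ suc zero))) (var (m ↑ʳ zero))
  ren-close-app² X = cong (λ t → app (app t _) _) (ren-close _ X)

  e' : apps (ren (m ↑ʳ_) (app (app (close C) (var (suc zero))) (var zero))) (vars m 2)
         =βη apps (ren (m ↑ʳ_) (app (app (close D) (var (suc zero))) (var zero))) (vars m 2)
  e' = trans (≡⇒=βη (cong (λ t → apps t (vars m 2)) (ren-close-app² C)))
             (trans e (≡⇒=βη (cong (λ t → apps t (vars m 2)) (≡.sym (ren-close-app² D)))))

extsⁿ : ∀ {n k} m → Sub n k → Sub (m + n) (m + k)
extsⁿ zero    σ = σ
extsⁿ (suc m) σ = exts (extsⁿ m σ)

sub-lams : ∀ {n k} m (σ : Sub n k) (b : Tm (m + n)) → sub σ (lams m b) ≡ lams m (sub (extsⁿ m σ) b)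
sub-lams zero    σ b = ≡.refl
sub-lams (suc m) σ b = sub-lams m σ (lam b)

extsⁿ-↑ʳ : ∀ {n k} m (σ : Sub n k) (i : Fin n) → extsⁿ m σ (m ↑ʳ i) ≡ ren (m ↑ʳ_) (σ i)
extsⁿ-↑ʳ zero    σ i = ≡.sym (ren-id (λ _ → ≡.refl) (σ i))
extsⁿ-↑ʳ (suc m) σ i = ≡.trans (cong (ren suc) (extsⁿ-↑ʳ m σ i)) (ren-ren (λ _ → ≡.refl) (σ i))

extsⁿ-↑ˡ : ∀ {n k} m (σ : Sub n k) (i : Fin m) → extsⁿ m σ (i ↑ˡ n) ≡ var (i ↑ˡ k)
extsⁿ-↑ˡ (suc m) σ zero    = ≡.refl
extsⁿ-↑ˡ (suc m) σ (suc i) = cong (ren suc) (extsⁿ-↑ˡ m σ i)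

arity-β : ∀ {M m n} (A : Arity M m n) {j} (h : Tm j) →
          apps (close M) (ren (m ↑ʳ_) h ∷ vars m j)
            =βη apps (ren (m ↑ʳ_) h) (map (ren (_↑ˡ j)) (Arity.args A))
arity-β {M} {m} (arity args eq) {j} h = begin
    apps (close M) (ren (m ↑ʳ_) h ∷ vars m j)
  ≡⟨ cong (λ t → apps (app t (ren (m ↑ʳ_) h)) (vars m j)) (ren-close _ M) ⟨
    apps (ren (m ↑ʳ_) (app (close M) h)) (vars m j)
  ≈⟨ apps-congˡ (vars m j) (ren-=βη (m ↑ʳ_) M-h) ⟩
    apps (ren (m ↑ʳ_) (lams m (sub (extsⁿ m σ) b))) (vars m j)
  ≈⟨ lams-β m _ ⟩
    sub (extsⁿ m σ) b
  ≡⟨ sub-apps (extsⁿ m σ) (var (m ↑ʳ zero)) (map (ren (_↑ˡ 1)) args) ⟩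
    apps (extsⁿ m σ (m ↑ʳ zero)) (map (sub (extsⁿ m σ)) (map (ren (_↑ˡ 1)) args))
  ≡⟨ cong₂ apps (extsⁿ-↑ʳ m σ zero) substitute-args ⟩
    apps (ren (m ↑ʳ_) h) (map (ren (_↑ˡ j)) args)
  ∎
  where
  open βη-Reasoning
  σ : Sub 1 j
  σ _ = h
  b : Tm (m + 1)
  b = apps (var (m ↑ʳ zero)) (map (ren (_↑ˡ 1)) args)

  M-h : app (close M) h =βη lams m (sub (extsⁿ m σ) b)
  M-h = trans (app-cong (close-=βη eq) refl) (trans (β _ h)
          (≡⇒=βη (≡.trans (sub-ren σ (λ { zero → ≡.refl }) (lams m b)) (sub-lams m σ b))))

  substitute-args : map (sub (extsⁿ m σ)) (map (ren (_↑ˡ 1)) args) ≡ map (ren (_↑ˡ j)) args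
  substitute-args = ≡.trans (≡.sym (map-∘ (sub (extsⁿ m σ)) (ren (_↑ˡ 1)) args))
    (map-cong (λ a → ≡.trans (sub-ren (λ i → var (i ↑ˡ j)) (extsⁿ-↑ˡ m σ) a)
                             (≡.sym (ren≡sub _ (λ _ → ≡.refl) a))) args)

arity⇒equation : ∀ {M m n} → Arity M m n → (M •) ∘ 𝐁^ (m + 1) =βη app 𝐁 M ∘ 𝐁^ n
arity⇒equation {M} {m} {n} A = closed-ext m (begin
    apps (app (close ((M •) ∘ 𝐁^ (m + 1))) z) (g ∷ xs)
  ≈⟨ •∘𝐁^-β M m z g xs ⟩
    app z (apps (close M) (g ∷ xs))
  ≈⟨ app-cong refl (arity-β A (var zero)) ⟩
    app z (apps g args)
  ≈⟨ 𝐁^-β n z g args ⟨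
    apps (app (app (close (𝐁^ n)) z) g) args
  ≡⟨ cong (λ t → apps (app (app t z) g) args) (ren-close _ (𝐁^ n)) ⟨
    apps (ren (m ↑ʳ_) h) args
  ≈⟨ arity-β A h ⟨
    apps (close M) (ren (m ↑ʳ_) h ∷ xs)
  ≡⟨ cong (λ t → apps (close M) (app (app t z) g ∷ xs)) (ren-close _ (𝐁^ n)) ⟩
    apps (close M) (app (app (close (𝐁^ n)) z) g ∷ xs)
  ≈⟨ 𝐁∘𝐁^-β M m n z g xs ⟨
    apps (app (close (app 𝐁 M ∘ 𝐁^ n)) z) (g ∷ xs)
  ∎)
  where
  open βη-Reasoning
  z g : Tm (m + 2)
  z = var (m ↑ʳ suc zero)
  g = var (m ↑ʳ zero)
  xs : Vec (Tm (m + 2)) m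
  xs = vars m 2
  args : Vec (Tm (m + 2)) n
  args = map (ren (_↑ˡ 2)) (Arity.args A)
  h : Tm 2
  h = app (app (close (𝐁^ n)) (var (suc zero))) (var zero)

equation⇒commutes : ∀ {M m n} → (M •) ∘ 𝐁^ (m + 1) =βη app 𝐁 M ∘ 𝐁^ n →
  ∀ {k} (z g : Tm k) (xs : Vec (Tm k) m) →
  apps (close M) (app (app (close (𝐁^ n)) z) g ∷ xs) =βη app z (apps (close M) (g ∷ xs))
equation⇒commutes {M} {m} {n} E z g xs = begin
    apps (close M) (app (app (close (𝐁^ n)) z) g ∷ xs)
  ≈⟨ 𝐁∘𝐁^-β M m n z g xs ⟨
    apps (app (close (app 𝐁 M ∘ 𝐁^ n)) z) (g ∷ xs)
  ≈⟨ apps-congˡ (g ∷ xs) (app-cong (close-=βη E) refl) ⟨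
    apps (app (close ((M •) ∘ 𝐁^ (m + 1))) z) (g ∷ xs)
  ≈⟨ •∘𝐁^-β M m z g xs ⟩
    app z (apps (close M) (g ∷ xs))
  ∎
  where open βη-Reasoning

equation⇒arity : ∀ {M m n} → (M •) ∘ 𝐁^ (m + 1) =βη app 𝐁 M ∘ 𝐁^ n → Arity M m n
equation⇒arity {M} {m} {n} E = arity args (begin
    M
  ≈⟨ close-η M ⟨
    lam (app (close M) (var zero))
  ≈⟨ lam-cong (lams-η m _) ⟨
    lam (lams m (apps (ren (m ↑ʳ_) (app (close M) (var zero))) xs))
  ≡⟨ cong (λ t → lam (lams m (apps (app t f) xs))) (ren-close _ M) ⟩
    lam (lams m (apps (close M) (f ∷ xs)))
  ≈⟨ lam-cong (lams-cong m M-f) ⟩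
    lam (lams m (apps f (map (ren (_↑ˡ 1)) args)))
  ∎)
  where
  open βη-Reasoning
  P : Tm m
  P = apps (close M) (close (𝐓 n) ∷ vars₀ m)
  args : Vec (Tm m) n
  args = project n P
  f : Tm (m + 1)
  f = var (m ↑ʳ zero)
  xs : Vec (Tm (m + 1)) m
  xs = vars m 1

  weaken-P : ren (_↑ˡ 1) P ≡ apps (close M) (close (𝐓 n) ∷ xs)
  weaken-P = ≡.trans (ren-apps _ (close M) (close (𝐓 n) ∷ vars₀ m))
    (cong₂ apps (ren-close _ M) (cong₂ _∷_ (ren-close _ (𝐓 n)) (map-↑ˡ-vars₀ m 1)))

  M-f : apps (close M) (f ∷ xs) =βη apps f (map (ren (_↑ˡ 1)) args)
  M-f = begin
      apps (close M) (f ∷ xs)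
    ≈⟨ apps-congˡ xs (app-cong refl (𝐁^-uncurry-𝐓 n f)) ⟨
      apps (close M) (app (app (close (𝐁^ n)) (uncurry n f)) (close (𝐓 n)) ∷ xs)
    ≈⟨ equation⇒commutes E (uncurry n f) (close (𝐓 n)) xs ⟩
      app (uncurry n f) (apps (close M) (close (𝐓 n) ∷ xs))
    ≈⟨ uncurry-β n f _ ⟩
      apps f (project n (apps (close M) (close (𝐓 n) ∷ xs)))
    ≡⟨ cong (λ t → apps f (project n t)) weaken-P ⟨
      apps f (project n (ren (_↑ˡ 1) P))
    ≡⟨ cong (apps f) (map-project n (ren (_↑ˡ 1)) (λ _ _ → ≡.refl) (ren-close _) P) ⟨
      apps f (map (ren (_↑ˡ 1)) args)
    ∎

proposition2p2 : (M : Closed) (m n : ℕ) →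
    Arity M m n ⇔ ((M •) ∘ 𝐁^ (m + 1) =βη app 𝐁 M ∘ 𝐁^ n)
proposition2p2 M m n = mk⇔ arity⇒equation equation⇒arity
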